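{- Let $A,B\subseteq\mathbb{N}$. Then $m(A\cup B)=m(A)+m(B)-m(A\cap B)$. In particular, if $A\cap B=\varnothing$, then $m(A\cup B)=m(A)+m(B)$.
   Context: Conway's surreal numbers form an ordered field; $\omega=\{0,1,2,\dots\mid\ \}$ is the first infinite surreal number. An omnific integer is a surreal number $x$ with $x=\{x-1\mid x+1\}$; the surnatural numbers $\mathbf{Nn}$ are the omnific integers $\ge 0$. $\mathbb{N}=\{1,2,\dots\}\subseteq\mathbf{Nn}$, $\mathbb{N}_0=\mathbb{N}\cup\{0\}$, $\omega\in\mathbf{Nn}$. For $A\subseteq\mathbb{N}$, $\kappa_A(n)=|A\cap\{1,\dots,n\}|$ is its counting sequence. Axiom of Extension (assumed throughout): every nondecreasing function $f:\mathbb{N}\to\mathbb{N}_0$ has an extension $\hat f:\mathbf{Nn}\to\mathbf{Nn}$ agreeing with $f$ on $\mathbb{N}$, such that for nondecreasing $f,g$: if $f(n)=g(n)$ for all sufficiently large $n$ then $\hat f(\nu)=\hat g(\nu)$ for all $\nu\in\mathbf{Nn}\setminus\mathbb{N}$; if $f(n)<g(n)$ for all sufficiently large $n$ then $\hat f(\nu)<\hat g(\nu)$ for all $\nu\in\mathbf{Nn}\setminus\mathbb{N}$; and $\widehat{f+g}=\hat f+\hat g$, $\widehat{f\cdot g}=\hat f\cdot\hat g$, $\widehat{f\circ g}=\hat f\circ\hat g$ (where defined). The magnum of $A\subseteq\mathbb{N}$ is $m(A):=\widehat{\kappa_A}(\omega)$. -}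

module Defs where

open import Level using (Level; suc; _⊔_)
open import Data.Nat as ℕ using (ℕ; zero; _≤_)
open import Data.Bool using (Bool; true; false; _∧_; _∨_)
open import Data.Product using (Σ; ∃; _×_; _,_)
open import Relation.Nullary using (¬_)
open import Algebra.Bundles using (CommutativeRing)
open import Data.Nat.Properties using (m≤m+n; ≤-refl; ≤-trans; m≤n⇒∃[o]m+o≡n; +-comm)
open import Relation.Binary.PropositionalEquality using (refl)

-- The paper's ℕ = {1,2,3,…}.  We encode ℕ by Agda's ℕ with a shift:
-- the Agda numeral k stands for the positive integer k+1.
--   * A subset A ⊆ ℕ is a characteristic function  A : ℕ → Bool,
--     with  A k ≡ true  iff  k+1 ∈ A.
--   * A sequence f : ℕ → ℕ₀ is an Agda function  f : ℕ → ℕ  with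
--     f k = the value at k+1.

Subset : Set
Subset = ℕ → Bool

_∪_ : Subset → Subset → Subset
(A ∪ B) k = A k ∨ B k

_∩_ : Subset → Subset → Subset
(A ∩ B) k = A k ∧ B k

Disjoint : Subset → Subset → Set
Disjoint A B = ∀ k → (A ∩ B) k ≡ false
  where open import Relation.Binary.PropositionalEquality using (_≡_)

𝟙 : Bool → ℕ
𝟙 true  = 1
𝟙 false = 0

-- counting sequence: κ A k = |A ∩ {1,…,k+1}|
κ : Subset → ℕ → ℕ
κ A zero    = 𝟙 (A zero)
κ A (ℕ.suc k) = κ A k ℕ.+ 𝟙 (A (ℕ.suc k))

Nondecreasing : (ℕ → ℕ) → Set
Nondecreasing f = ∀ {m n} → m ≤ n → f m ≤ f n

private
  κ-step : ∀ A k → κ A k ≤ κ A (ℕ.suc k)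
  κ-step A k = m≤m+n (κ A k) (𝟙 (A (ℕ.suc k)))

  κ-le : ∀ A m d → κ A m ≤ κ A (d ℕ.+ m)
  κ-le A m zero = ≤-refl
  κ-le A m (ℕ.suc d) = ≤-trans (κ-le A m d) (κ-step A (d ℕ.+ m))

κ-mono : ∀ A → Nondecreasing (κ A)
κ-mono A {m} {n} m≤n with m≤n⇒∃[o]m+o≡n m≤n
... | d , refl rewrite +-comm m d = κ-le A m d

-- The surreal setting, abstracted: a commutative ring (the ring
-- structure of No) with a strict order, a predicate singling out the
-- surnatural numbers Nn, the element ω ∈ Nn∖ℕ, and an extension
-- operator satisfying the Axiom of Extension.

module _ {c ℓ : Level} (R : CommutativeRing c ℓ) where
  open CommutativeRing R

  ι : ℕ → Carrier
  ι zero      = 0#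
  ι (ℕ.suc n) = 1# + ι n

  ι⁺ : ℕ → Carrier
  ι⁺ k = ι (ℕ.suc k)

  EventuallyEq : (ℕ → ℕ) → (ℕ → ℕ) → Set
  EventuallyEq f g = Σ ℕ λ N → ∀ n → N ≤ n → f n ≡ g n
    where open import Relation.Binary.PropositionalEquality using (_≡_)

  EventuallyLt : (ℕ → ℕ) → (ℕ → ℕ) → Set
  EventuallyLt f g = Σ ℕ λ N → ∀ n → N ≤ n → f n ℕ.< g n

  record SurrealExtension (ℓn : Level) : Set (suc (c ⊔ ℓ ⊔ ℓn)) where
    field
      _<ₛ_ : Carrier → Carrier → Set ℓ
      Nn   : Carrier → Set ℓn
      ℕ⊆Nn : ∀ n → Nn (ι n)
      ω    : Carrier
      ω∈Nn : Nn ω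
      ω∉ℕ  : ∀ n → ¬ (ω ≈ ι n)
      ext  : (f : ℕ → ℕ) → Nondecreasing f → Carrier → Carrier
      ext-Nn : ∀ f (p : Nondecreasing f) ν → Nn ν → Nn (ext f p ν)
      ext-agrees : ∀ f (p : Nondecreasing f) k → ext f p (ι⁺ k) ≈ ι (f k)
      ext-eq : ∀ f g (p : Nondecreasing f) (q : Nondecreasing g) →
               EventuallyEq f g →
               ∀ ν → Nn ν → (∀ n → ¬ (ν ≈ ι n)) → ext f p ν ≈ ext g q ν
      ext-lt : ∀ f g (p : Nondecreasing f) (q : Nondecreasing g) →
               EventuallyLt f g →
               ∀ ν → Nn ν → (∀ n → ¬ (ν ≈ ι n)) → ext f p ν <ₛ ext g q ν
      ext-+ : ∀ f g (p : Nondecreasing f) (q : Nondecreasing g)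
              (r : Nondecreasing (λ n → f n ℕ.+ g n)) →
              ∀ ν → Nn ν → ext (λ n → f n ℕ.+ g n) r ν ≈ ext f p ν + ext g q ν
      ext-* : ∀ f g (p : Nondecreasing f) (q : Nondecreasing g)
              (r : Nondecreasing (λ n → f n ℕ.* g n)) →
              ∀ ν → Nn ν → ext (λ n → f n ℕ.* g n) r ν ≈ ext f p ν * ext g q ν
      -- composition, defined when g takes values in ℕ = {1,2,…}:
      -- in the shifted encoding (f ∘ g)(k) = f (g k ∸ 1)
      ext-∘ : ∀ f g (p : Nondecreasing f) (q : Nondecreasing g) →
              (∀ n → 1 ≤ g n) →
              (r : Nondecreasing (λ n → f (g n ℕ.∸ 1))) →
              ∀ ν → Nn ν → ext (λ n → f (g n ℕ.∸ 1)) r ν ≈ ext f p (ext g q ν)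

  module _ {ℓn : Level} (S : SurrealExtension ℓn) where
    open SurrealExtension S

    magnum : Subset → Carrier
    magnum A = ext (κ A) (κ-mono A) ω

-- Pointwise, κ (A ∪ B) + κ (A ∩ B) = κ A + κ B, so the two sides have the same extension at ω;
-- additivity of the extension turns this into m(A ∪ B) + m(A ∩ B) = m(A) + m(B), and an empty
-- intersection has magnum 0 because the zero sequence extends to an additive idempotent.
module Submission where

open import Defs
open import Level using (Level)
open import Data.Product using (_×_; _,_)
open import Data.Bool using (Bool; true; false; _∧_; _∨_)
open import Data.Nat as ℕ using (zero; suc; z≤n)
open import Data.Nat.Properties using (+-mono-≤; +-commutativeSemigroup)
open import Algebra.Bundles using (CommutativeRing)
open import Algebra.Properties.CommutativeSemigroup +-commutativeSemigroup using (interchange)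
import Algebra.Properties.Group as GroupProperties
open import Relation.Binary.PropositionalEquality using (_≡_; refl; cong₂; module ≡-Reasoning)
import Relation.Binary.Reasoning.Setoid as SetoidReasoning

𝟙-∨+𝟙-∧ : ∀ a b → 𝟙 (a ∨ b) ℕ.+ 𝟙 (a ∧ b) ≡ 𝟙 a ℕ.+ 𝟙 b
𝟙-∨+𝟙-∧ true  true  = refl
𝟙-∨+𝟙-∧ true  false = refl
𝟙-∨+𝟙-∧ false true  = refl
𝟙-∨+𝟙-∧ false false = refl

κ-∪+κ-∩ : ∀ A B n → κ (A ∪ B) n ℕ.+ κ (A ∩ B) n ≡ κ A n ℕ.+ κ B n
κ-∪+κ-∩ A B zero    = 𝟙-∨+𝟙-∧ (A zero) (B zero)
κ-∪+κ-∩ A B (suc n) = begin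
  (κ (A ∪ B) n ℕ.+ 𝟙 (a ∨ b)) ℕ.+ (κ (A ∩ B) n ℕ.+ 𝟙 (a ∧ b))
    ≡⟨ interchange (κ (A ∪ B) n) (𝟙 (a ∨ b)) (κ (A ∩ B) n) (𝟙 (a ∧ b)) ⟩
  (κ (A ∪ B) n ℕ.+ κ (A ∩ B) n) ℕ.+ (𝟙 (a ∨ b) ℕ.+ 𝟙 (a ∧ b))
    ≡⟨ cong₂ ℕ._+_ (κ-∪+κ-∩ A B n) (𝟙-∨+𝟙-∧ a b) ⟩
  (κ A n ℕ.+ κ B n) ℕ.+ (𝟙 a ℕ.+ 𝟙 b)
    ≡⟨ interchange (κ A n) (κ B n) (𝟙 a) (𝟙 b) ⟩
  (κ A n ℕ.+ 𝟙 a) ℕ.+ (κ B n ℕ.+ 𝟙 b) ∎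
  where
  open ≡-Reasoning
  a b : Bool
  a = A (suc n)
  b = B (suc n)

κ-empty : ∀ {A} → (∀ k → A k ≡ false) → ∀ n → κ A n ≡ 0
κ-empty A-empty zero    rewrite A-empty zero = refl
κ-empty A-empty (suc n) rewrite A-empty (suc n) | κ-empty A-empty n = refl

+-nondecreasing : ∀ {f g} → Nondecreasing f → Nondecreasing g → Nondecreasing (λ n → f n ℕ.+ g n)
+-nondecreasing f↑ g↑ m≤n = +-mono-≤ (f↑ m≤n) (g↑ m≤n)

module _ {c ℓ ℓn : Level} (R : CommutativeRing c ℓ) (S : SurrealExtension R ℓn) where
  open CommutativeRing R
  open SurrealExtension S
  open GroupProperties +-group using (x≈z//y; identityʳ-unique)
  open SetoidReasoning setoid

  private
    m : Subset → Carrier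
    m = magnum R S

  ext-zero : ∀ ν → Nn ν → ext (λ _ → 0) (λ _ → z≤n) ν ≈ 0#
  ext-zero ν ν∈Nn = identityʳ-unique z z (sym (ext-+ _ _ _ _ (λ _ → z≤n) ν ν∈Nn))
    where
    z : Carrier
    z = ext (λ _ → 0) (λ _ → z≤n) ν

  magnum-empty : ∀ {A} → (∀ k → A k ≡ false) → m A ≈ 0#
  magnum-empty {A} A-empty = begin
    m A                             ≈⟨ ext-eq _ _ (κ-mono A) (λ _ → z≤n) (0 , λ n _ → κ-empty A-empty n) ω ω∈Nn ω∉ℕ ⟩
    ext (λ _ → 0) (λ _ → z≤n) ω     ≈⟨ ext-zero ω ω∈Nn ⟩
    0#                              ∎

  magnum-∪+magnum-∩ : ∀ A B → m (A ∪ B) + m (A ∩ B) ≈ m A + m B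
  magnum-∪+magnum-∩ A B = begin
    m (A ∪ B) + m (A ∩ B)
      ≈⟨ ext-+ _ _ (κ-mono (A ∪ B)) (κ-mono (A ∩ B)) ∪∩↑ ω ω∈Nn ⟨
    ext (λ n → κ (A ∪ B) n ℕ.+ κ (A ∩ B) n) ∪∩↑ ω
      ≈⟨ ext-eq _ _ ∪∩↑ AB↑ (0 , λ n _ → κ-∪+κ-∩ A B n) ω ω∈Nn ω∉ℕ ⟩
    ext (λ n → κ A n ℕ.+ κ B n) AB↑ ω
      ≈⟨ ext-+ _ _ (κ-mono A) (κ-mono B) AB↑ ω ω∈Nn ⟩
    m A + m B ∎
    where
    ∪∩↑ : Nondecreasing (λ n → κ (A ∪ B) n ℕ.+ κ (A ∩ B) n)
    ∪∩↑ = +-nondecreasing (κ-mono (A ∪ B)) (κ-mono (A ∩ B))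
    AB↑ : Nondecreasing (λ n → κ A n ℕ.+ κ B n)
    AB↑ = +-nondecreasing (κ-mono A) (κ-mono B)

  magnum-∪ : ∀ A B → m (A ∪ B) ≈ (m A + m B) - m (A ∩ B)
  magnum-∪ A B = x≈z//y _ _ _ (magnum-∪+magnum-∩ A B)

  magnum-∪-disjoint : ∀ A B → Disjoint A B → m (A ∪ B) ≈ m A + m B
  magnum-∪-disjoint A B A∩B-empty = begin
    m (A ∪ B)              ≈⟨ +-identityʳ _ ⟨
    m (A ∪ B) + 0#         ≈⟨ +-congˡ (magnum-empty A∩B-empty) ⟨
    m (A ∪ B) + m (A ∩ B)  ≈⟨ magnum-∪+magnum-∩ A B ⟩
    m A + m B              ∎

theorem11 : {c ℓ ℓn : Level} (R : CommutativeRing c ℓ) (S : SurrealExtension R ℓn) →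
              let open CommutativeRing R in
              (∀ (A B : Subset) →
                 magnum R S (A ∪ B) ≈ (magnum R S A + magnum R S B) - magnum R S (A ∩ B))
              × (∀ (A B : Subset) → Disjoint A B →
                 magnum R S (A ∪ B) ≈ magnum R S A + magnum R S B)
theorem11 R S = magnum-∪ R S , magnum-∪-disjoint R S
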